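{- Let $G$ and $H$ be two nontrivial traceable graphs with $|V(G)|=n$ and $|V(H)|=m$. Then $tpc(G\square H)=3$.
   Context: All graphs are simple, finite and undirected. A graph is traceable if it has a Hamiltonian path (a path containing every vertex). A graph is total-colored if all its vertices and edges are assigned colors. A path in a total-colored graph is a total proper path if (i) any two adjacent edges on the path differ in color, (ii) any two adjacent internal vertices of the path differ in color, and (iii) every internal vertex of the path differs in color from the edges of the path incident with it. A total-colored graph is total-proper connected if any two vertices are joined by a total proper path. For a connected graph $G$, $tpc(G)$ is the smallest number of colors in a total-coloring making $G$ total-proper connected. The Cartesian product $G\square H$ has vertex set $V(G)\times V(H)$, with $(g,h)$ adjacent to $(g',h')$ iff either $g=g'$ and $hh'\in E(H)$, or $h=h'$ and $gg'\in E(G)$. -}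

module Defs where

open import Data.Nat using (ℕ; _≤_)
open import Data.Fin using (Fin)
open import Data.Product using (Σ; ∃; _×_; _,_)
open import Data.Unit using (⊤)
open import Data.List using (List; []; _∷_)
open import Data.List.Membership.Propositional using (_∈_)
open import Data.List.Relation.Unary.Unique.Propositional using (Unique)
open import Data.List.Relation.Unary.Linked using (Linked)
open import Data.List.Relation.Unary.Any using (Any)
open import Relation.Binary.PropositionalEquality using (_≡_; _≢_)
open import Relation.Nullary using (¬_)

record Graph (V : Set) : Set₁ where
  field
    Adj   : V → V → Set
    sym   : ∀ {u v} → Adj u v → Adj v u
    irrefl : ∀ {v} → ¬ Adj v v
open Graph public

FinGraph : ℕ → Set₁
FinGraph n = Graph (Fin n)

_□_ : ∀ {V W : Set} → Graph V → Graph W → Graph (V × W)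
_□_ {V} {W} G H = record { Adj = A ; sym = s ; irrefl = i }
  where
  A : V × W → V × W → Set
  A (g , h) (g' , h') = (g ≡ g' × Adj H h h') ⊎' (h ≡ h' × Adj G g g')
    where
    open import Data.Sum renaming (_⊎_ to _⊎'_)
  open import Data.Sum using (inj₁; inj₂)
  open import Relation.Binary.PropositionalEquality using (refl) renaming (sym to ≡sym)
  s : ∀ {u v} → A u v → A v u
  s (inj₁ (refl , a)) = inj₁ (refl , Graph.sym H a)
  s (inj₂ (refl , a)) = inj₂ (refl , Graph.sym G a)
  i : ∀ {v} → ¬ A v v
  i (inj₁ (_ , a)) = Graph.irrefl H a
  i (inj₂ (_ , a)) = Graph.irrefl G a

IsPath : ∀ {V} → Graph V → List V → Set
IsPath G p = Unique p × Linked (Adj G) p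

Traceable : ∀ {V} → Graph V → Set
Traceable {V} G = Σ (List V) λ p → IsPath G p × (∀ v → v ∈ p)

Nontrivial : ℕ → Set
Nontrivial n = 2 ≤ n

-- Edge colors are given by a function on ordered pairs that must
-- be symmetric on edges (its values on non-edges are irrelevant).
record TotalColoring {V : Set} (G : Graph V) (k : ℕ) : Set where
  field
    vcol : V → Fin k
    ecol : V → V → Fin k
    ecol-sym : ∀ {u v} → Adj G u v → ecol u v ≡ ecol v u
open TotalColoring public

module _ {V : Set} {G : Graph V} {k : ℕ} (c : TotalColoring G k) where
  -- conditions at an internal vertex b with path-neighbours a, c':
  -- (i) the two path edges at b differ; (iii) b differs from both.
  TPTriple : V → V → V → Set
  TPTriple a b c' = (ecol c a b ≢ ecol c b c')
                  × (vcol c b ≢ ecol c a b)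
                  × (vcol c b ≢ ecol c b c')

  -- Total-proper conditions (i)-(iii) along a vertex sequence.
  -- In a list a ∷ b ∷ c' ∷ d ∷ _, both b and c' are internal, so (ii)
  -- requires their colors to differ.
  TotalProper : List V → Set
  TotalProper (a ∷ b ∷ c' ∷ d ∷ r) =
    TPTriple a b c' × (vcol c b ≢ vcol c c') × TotalProper (b ∷ c' ∷ d ∷ r)
  TotalProper (a ∷ b ∷ c' ∷ []) = TPTriple a b c'
  TotalProper _ = ⊤

TotalProperPath : ∀ {V} {G : Graph V} {k} → TotalColoring G k → V → V → List V → Set
TotalProperPath {G = G} c x y p =
  IsPath G p × Data.List.head p ≡ Data.Maybe.just x × Data.List.last p ≡ Data.Maybe.just y × TotalProper c p
  where
  import Data.List
  import Data.Maybe

TPConnectedBy : ∀ {V} {G : Graph V} {k} → TotalColoring G k → Set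
TPConnectedBy {V} c = ∀ (x y : V) → Σ (List V) λ p → TotalProperPath c x y p

TPConnectable : ∀ {V} → Graph V → ℕ → Set
TPConnectable G k = Σ (TotalColoring G k) TPConnectedBy

TPC≡ : ∀ {V} → Graph V → ℕ → Set
TPC≡ G k = TPConnectable G k × (∀ j → TPConnectable G j → k ≤ j)

-- If L = v₀ v₁ … is a Hamiltonian path of a graph, color vᵢ
-- with i mod 3 and every edge with the one color missing at its two ends.
-- Along any sub-path of L, read in either direction, the vertex colors then
-- advance by a rotation τ of the three colors without fixed points, and the
-- colors around an internal vertex b are τ(c), c, τ²(c) (edge, vertex, edge)
-- with c the color of b: pairwise distinct, so every sub-path is total
-- proper.  Any two vertices lie on L, hence every traceable graph with
-- decidable vertex equality satisfies tpc ≤ 3.  The product of traceable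
-- graphs is traceable (the boustrophedon "snake" through the rows), so this
-- applies to G □ H.
--
-- A total proper path between distinct non-adjacent vertices
-- has an internal vertex, whose color and the colors of its two path edges
-- are pairwise distinct, so at least three colors are used.  In G □ H the
-- vertices (0,0) and (1,1) are distinct and non-adjacent.
module Submission where

open import Defs hiding (sym)
open import Data.Nat using (ℕ; _≤_; _≤?_; s≤s; z≤n)
open import Data.Nat.Properties using (≰⇒>)
open import Data.Fin using (Fin; zero; suc)
open import Data.Fin.Properties using (pigeonhole; _≟_)
open import Data.Vec using (_∷_; [])
import Data.Vec as Vec
open import Data.Product using (Σ; _×_; _,_; proj₁; proj₂)
open import Data.Product.Properties using (≡-dec)
open import Data.Sum using (inj₁; inj₂)
open import Data.Unit using (tt)
open import Data.Empty using (⊥-elim)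
open import Data.List using (List; []; _∷_; _++_; map; head; last; reverse; reverseAcc)
open import Data.List.Properties using (reverse-involutive; last-map)
open import Data.Maybe using (Maybe; just; nothing)
open import Data.Maybe.Relation.Binary.Connected using (Connected; just; just-nothing; nothing-just; nothing)
import Data.Maybe.Relation.Binary.Connected as Connected
open import Data.List.Relation.Unary.All using (All; []; _∷_)
import Data.List.Relation.Unary.All as All
open import Data.List.Relation.Unary.AllPairs using ([]; _∷_)
open import Data.List.Relation.Unary.Any using (here; there)
import Data.List.Relation.Unary.Any.Properties as Any
open import Data.List.Relation.Unary.Linked using (Linked; []; [-]; _∷_; _∷′_)
import Data.List.Relation.Unary.Linked as Linked
import Data.List.Relation.Unary.Linked.Properties as Linked
open import Data.List.Membership.Propositional using (_∈_)
open import Data.List.Membership.Propositional.Properties using (∈-map⁺; ∈-map⁻; ∈-++⁺ˡ; ∈-++⁺ʳ; ∈-++⁻)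
open import Data.List.Relation.Unary.Unique.Propositional using (Unique)
import Data.List.Relation.Unary.Unique.Propositional.Properties as Unique
open import Data.List.Relation.Binary.Disjoint.Propositional using (Disjoint)
import Data.List.Relation.Binary.Permutation.Setoid as Permutation
import Data.List.Relation.Binary.Permutation.Setoid.Properties as Permutation
open import Function using (flip; id)
open import Relation.Binary using (DecidableEquality)
open import Relation.Binary.PropositionalEquality
  using (_≡_; _≢_; refl; sym; trans; cong; subst; subst₂; setoid; module ≡-Reasoning)
open import Relation.Nullary using (¬_; yes; no)

next : Fin 3 → Fin 3
next zero = suc zero
next (suc zero) = suc (suc zero)
next (suc (suc zero)) = zero

prev : Fin 3 → Fin 3
prev zero = suc (suc zero)
prev (suc zero) = zero
prev (suc (suc zero)) = suc zero

prev-next : ∀ x → prev (next x) ≡ x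
prev-next zero = refl
prev-next (suc zero) = refl
prev-next (suc (suc zero)) = refl

-- The color different from two distinct colors (the value on equal
-- arguments is irrelevant); it is the color of an edge.
third : Fin 3 → Fin 3 → Fin 3
third zero (suc zero) = suc (suc zero)
third (suc zero) zero = suc (suc zero)
third zero (suc (suc zero)) = suc zero
third (suc (suc zero)) zero = suc zero
third (suc zero) (suc (suc zero)) = zero
third (suc (suc zero)) (suc zero) = zero
third x _ = x

third-sym : ∀ x y → third x y ≡ third y x
third-sym zero zero = refl
third-sym zero (suc zero) = refl
third-sym zero (suc (suc zero)) = refl
third-sym (suc zero) zero = refl
third-sym (suc zero) (suc zero) = refl
third-sym (suc zero) (suc (suc zero)) = refl
third-sym (suc (suc zero)) zero = refl
third-sym (suc (suc zero)) (suc zero) = refl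
third-sym (suc (suc zero)) (suc (suc zero)) = refl

-- These are exactly the facts about the
-- colors met around an internal vertex of a path whose colors advance by τ.
record Rotation (τ : Fin 3 → Fin 3) : Set where
  field
    moves      : ∀ x → x ≢ τ x
    moves²     : ∀ x → x ≢ τ (τ x)
    third-step : ∀ x → third x (τ x) ≡ τ (τ x)

next-rotation : Rotation next
next-rotation = record
  { moves      = λ { zero () ; (suc zero) () ; (suc (suc zero)) () }
  ; moves²     = λ { zero () ; (suc zero) () ; (suc (suc zero)) () }
  ; third-step = λ { zero → refl ; (suc zero) → refl ; (suc (suc zero)) → refl }
  }

prev-rotation : Rotation prev
prev-rotation = record
  { moves      = λ { zero () ; (suc zero) () ; (suc (suc zero)) () }
  ; moves²     = λ { zero () ; (suc zero) () ; (suc (suc zero)) () }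
  ; third-step = λ { zero → refl ; (suc zero) → refl ; (suc (suc zero)) → refl }
  }

three-distinct⇒3≤ : ∀ {k} (a b c : Fin k) → a ≢ b → a ≢ c → b ≢ c → 3 ≤ k
three-distinct⇒3≤ {k} a b c a≢b a≢c b≢c with 3 ≤? k
... | yes 3≤k = 3≤k
... | no 3≰k with pigeonhole (≰⇒> 3≰k) (Vec.lookup (a ∷ b ∷ c ∷ []))
...   | zero , suc zero , _ , e = ⊥-elim (a≢b e)
...   | zero , suc (suc zero) , _ , e = ⊥-elim (a≢c e)
...   | suc zero , suc (suc zero) , _ , e = ⊥-elim (b≢c e)
...   | _ , zero , () , _
...   | suc zero , suc zero , s≤s () , _
...   | suc (suc zero) , suc zero , s≤s () , _
...   | suc (suc zero) , suc (suc zero) , s≤s (s≤s ()) , _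

module _ {A : Set} where

  nothing-connected : ∀ {R : A → A → Set} {m : Maybe A} → Connected R nothing m
  nothing-connected {m = just _} = nothing-just
  nothing-connected {m = nothing} = nothing

  connected-nothing : ∀ {R : A → A → Set} {m : Maybe A} → Connected R m nothing
  connected-nothing {m = just _} = just-nothing
  connected-nothing {m = nothing} = nothing

  reverseAcc-Linked : ∀ {R : A → A → Set} {acc xs} → Linked (flip R) acc →
                      Connected R (head acc) (head xs) → Linked R xs →
                      Linked (flip R) (reverseAcc acc xs)
  reverseAcc-Linked lacc _ [] = lacc
  reverseAcc-Linked {xs = _ ∷ _} lacc c lxs =
    reverseAcc-Linked (Connected.sym id c ∷′ lacc) (Linked.head′ lxs) (Linked.tail lxs)

  reverse-Linked : ∀ {R : A → A → Set} {xs} → Linked R xs → Linked (flip R) (reverse xs)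
  reverse-Linked = reverseAcc-Linked [] nothing-connected

  head-reverse : ∀ (xs : List A) → head (reverse xs) ≡ last xs
  head-reverse [] = refl
  head-reverse (x ∷ xs) = go [] x xs
    where
    go : ∀ acc x (xs : List A) → head (reverseAcc acc (x ∷ xs)) ≡ last (x ∷ xs)
    go acc x [] = refl
    go acc x (y ∷ ys) = go (x ∷ acc) y ys

  last-reverse : ∀ (xs : List A) → last (reverse xs) ≡ head xs
  last-reverse xs = trans (sym reversed-twice) (cong head (reverse-involutive xs))
    where
    reversed-twice : head (reverse (reverse xs)) ≡ last (reverse xs)
    reversed-twice = head-reverse (reverse xs)

  reverse-Unique : ∀ {xs} → Unique xs → Unique (reverse xs)
  reverse-Unique {xs} =
    Permutation.Unique-resp-↭ (setoid A)
      (Permutation.↭-sym (setoid A) (Permutation.↭-reverse (setoid A) xs))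

reverse-IsPath : ∀ {V} (G : Graph V) {p} → IsPath G p → IsPath G (reverse p)
reverse-IsPath G (u , l) = reverse-Unique u , Linked.map (Graph.sym G) (reverse-Linked l)

module _ {A : Set} where

  prefixTo : ∀ {y : A} {xs} → y ∈ xs → List A
  prefixTo {xs = x ∷ _} (here _) = x ∷ []
  prefixTo {xs = x ∷ _} (there m) = x ∷ prefixTo m

  prefixTo-head : ∀ {x y : A} {xs} (m : y ∈ x ∷ xs) → head (prefixTo m) ≡ just x
  prefixTo-head (here _) = refl
  prefixTo-head (there _) = refl

  prefixTo-last : ∀ {y : A} {xs} (m : y ∈ xs) → last (prefixTo m) ≡ just y
  prefixTo-last (here refl) = refl
  prefixTo-last (there (here refl)) = refl
  prefixTo-last (there (there m)) = prefixTo-last (there m)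

  prefixTo-Linked : ∀ {R : A → A → Set} {y xs} → Linked R xs → (m : y ∈ xs) → Linked R (prefixTo m)
  prefixTo-Linked _ (here _) = [-]
  prefixTo-Linked (r ∷ _) (there (here _)) = r ∷ [-]
  prefixTo-Linked (r ∷ l) (there (there m)) = r ∷ prefixTo-Linked l (there m)

  prefixTo-All : ∀ {P : A → Set} {y xs} → All P xs → (m : y ∈ xs) → All P (prefixTo m)
  prefixTo-All (px ∷ _) (here _) = px ∷ []
  prefixTo-All (px ∷ pxs) (there m) = px ∷ prefixTo-All pxs m

  prefixTo-Unique : ∀ {y xs} → Unique xs → (m : y ∈ xs) → Unique (prefixTo {y = y} m)
  prefixTo-Unique (_ ∷ _) (here _) = [] ∷ []
  prefixTo-Unique (x∉ ∷ u) (there m) = prefixTo-All x∉ m ∷ prefixTo-Unique u m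

prefixTo-IsPath : ∀ {V} (G : Graph V) {y xs} → IsPath G xs → (m : y ∈ xs) → IsPath G (prefixTo m)
prefixTo-IsPath G (u , l) m = prefixTo-Unique u m , prefixTo-Linked l m

IsPath-tail : ∀ {V} (G : Graph V) {x xs} → IsPath G (x ∷ xs) → IsPath G xs
IsPath-tail G (_ ∷ u , l) = u , Linked.tail l

threeColoring : ∀ {V} (G : Graph V) → (V → Fin 3) → TotalColoring G 3
threeColoring G f = record
  { vcol = f
  ; ecol = λ u v → third (f u) (f v)
  ; ecol-sym = λ {u} {v} _ → third-sym (f u) (f v)
  }

Steps : ∀ {V : Set} → (V → Fin 3) → (Fin 3 → Fin 3) → List V → Set
Steps f τ = Linked (λ u v → f v ≡ τ (f u))

steps-cong : ∀ {V} {f g : V → Fin 3} τ {M} → All (λ v → f v ≡ g v) M → Steps f τ M → Steps g τ M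
steps-cong τ _ [] = []
steps-cong τ _ [-] = [-]
steps-cong τ (fu≡gu ∷ agree@(fv≡gv ∷ _)) (s ∷ rest) =
  trans (sym fv≡gv) (trans s (cong τ fu≡gu)) ∷ steps-cong τ agree rest

reverse-Steps : ∀ {V} {f : V → Fin 3} {p} → Steps f next p → Steps f prev (reverse p)
reverse-Steps {f = f} s = Linked.map back (reverse-Linked s)
  where
  back : ∀ {u v} → f u ≡ next (f v) → f v ≡ prev (f u)
  back {u} {v} e = trans (sym (prev-next (f v))) (cong prev (sym e))

module _ {V : Set} (G : Graph V) (f : V → Fin 3) {τ : Fin 3 → Fin 3} (rot : Rotation τ) where
  open Rotation rot

  private
    col : TotalColoring G 3
    col = threeColoring G f

  edge-color : ∀ {u v} → f v ≡ τ (f u) → ecol col u v ≡ τ (f v)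
  edge-color {u} {v} e = begin
    third (f u) (f v)        ≡⟨ cong (third (f u)) e ⟩
    third (f u) (τ (f u))    ≡⟨ third-step (f u) ⟩
    τ (τ (f u))              ≡⟨ cong τ (sym e) ⟩
    τ (f v)                  ∎
    where open ≡-Reasoning

  -- At b the colors met are τ(f b), f b, τ²(f b): pairwise distinct.
  internal-proper : ∀ {a b c} → f b ≡ τ (f a) → f c ≡ τ (f b) → TPTriple col a b c
  internal-proper {a} {b} {c} sab sbc =
    subst₂ _≢_ (sym eab) (sym ebc) (moves (τ (f b))) ,
    subst (f b ≢_) (sym eab) (moves (f b)) ,
    subst (f b ≢_) (sym ebc) (moves² (f b))
    where
    eab : ecol col a b ≡ τ (f b)
    eab = edge-color sab
    ebc : ecol col b c ≡ τ (τ (f b))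
    ebc = trans (edge-color sbc) (cong τ sbc)

  -- Condition (ii) holds because consecutive vertex colors differ.
  steps⇒TotalProper : ∀ {p} → Steps f τ p → TotalProper col p
  steps⇒TotalProper [] = tt
  steps⇒TotalProper [-] = tt
  steps⇒TotalProper (_ ∷ [-]) = tt
  steps⇒TotalProper (sab ∷ sbc ∷ [-]) = internal-proper sab sbc
  steps⇒TotalProper {_ ∷ b ∷ _} (sab ∷ sbc ∷ rest@(_ ∷ _)) =
    internal-proper sab sbc ,
    subst (f b ≢_) (sym sbc) (moves (f b)) ,
    steps⇒TotalProper (sbc ∷ rest)

-- Between any two vertices of a path whose colors advance by next there is
-- a total proper path: the segment between them, read in the right direction.
segment : ∀ {V} (G : Graph V) (f : V → Fin 3) {x y} L → IsPath G L → Steps f next L →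
          x ∈ L → y ∈ L → Σ (List V) (TotalProperPath (threeColoring G f) x y)
segment G f (a ∷ L) path steps (here refl) y∈ =
  prefixTo y∈ , prefixTo-IsPath G path y∈ , prefixTo-head y∈ , prefixTo-last y∈ ,
  steps⇒TotalProper G f next-rotation (prefixTo-Linked steps y∈)
segment {V} G f (a ∷ L) path steps (there x∈) (here refl) =
  reverse q , reverse-IsPath G (prefixTo-IsPath G path (there x∈)) ,
  trans (head-reverse q) (prefixTo-last (there x∈)) ,
  trans (last-reverse q) (prefixTo-head (there x∈)) ,
  steps⇒TotalProper G f prev-rotation (reverse-Steps (prefixTo-Linked steps (there x∈)))
  where
  q : List V
  q = prefixTo (there x∈)
segment G f (a ∷ L) path steps (there x∈) (there y∈) =
  segment G f L (IsPath-tail G path) (Linked.tail steps) x∈ y∈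

-- Coloring along a list: the i-th entry of L gets color nextⁱ(c).
module ColorAlong {V : Set} (_≟ᵥ_ : DecidableEquality V) where

  colorFrom : Fin 3 → List V → V → Fin 3
  colorFrom c [] v = c
  colorFrom c (a ∷ L) v with v ≟ᵥ a
  ... | yes _ = c
  ... | no _ = colorFrom (next c) L v

  colorFrom-here : ∀ c a L → colorFrom c (a ∷ L) a ≡ c
  colorFrom-here c a L with a ≟ᵥ a
  ... | yes _ = refl
  ... | no a≢a = ⊥-elim (a≢a refl)

  colorFrom-skip : ∀ c {a v} L → a ≢ v → colorFrom c (a ∷ L) v ≡ colorFrom (next c) L v
  colorFrom-skip c {a} {v} L a≢v with v ≟ᵥ a
  ... | yes v≡a = ⊥-elim (a≢v (sym v≡a))
  ... | no _ = refl

  colorFrom-Steps : ∀ c L → Unique L → Steps (colorFrom c L) next L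
  colorFrom-Steps c [] _ = []
  colorFrom-Steps c (a ∷ []) _ = [-]
  colorFrom-Steps c (a ∷ b ∷ r) ((a≢b ∷ a∉r) ∷ u) = first ∷ later
    where
    open ≡-Reasoning
    first : colorFrom c (a ∷ b ∷ r) b ≡ next (colorFrom c (a ∷ b ∷ r) a)
    first = begin
      colorFrom c (a ∷ b ∷ r) b         ≡⟨ colorFrom-skip c (b ∷ r) a≢b ⟩
      colorFrom (next c) (b ∷ r) b      ≡⟨ colorFrom-here (next c) b r ⟩
      next c                            ≡⟨ cong next (sym (colorFrom-here c a (b ∷ r))) ⟩
      next (colorFrom c (a ∷ b ∷ r) a)  ∎
    later : Steps (colorFrom c (a ∷ b ∷ r)) next (b ∷ r)
    later = steps-cong next (All.map (λ a≢v → sym (colorFrom-skip c (b ∷ r) a≢v)) (a≢b ∷ a∉r))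
                       (colorFrom-Steps (next c) (b ∷ r) u)

traceable⇒tpc≤3 : ∀ {V} (G : Graph V) → DecidableEquality V → Traceable G → TPConnectable G 3
traceable⇒tpc≤3 {V} G _≟ᵥ_ (L , path@(unique , _) , covers) =
  threeColoring G f ,
  λ x y → segment G f L path (colorFrom-Steps zero L unique) (covers x) (covers y)
  where
  open ColorAlong _≟ᵥ_
  f : V → Fin 3
  f = colorFrom zero L

module Snake {V W : Set} (G : Graph V) (H : Graph W) where

  row : W → List V → List (V × W)
  row h = map (_, h)

  snake : List V → List W → List (V × W)
  snake p [] = []
  snake p (h ∷ hs) = row h p ++ snake (reverse p) hs

  row-Linked : ∀ {h p} → Linked (Adj G) p → Linked (Adj (G □ H)) (row h p)
  row-Linked l = Linked.map⁺ (Linked.map (λ a → inj₂ (refl , a)) l)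

  -- The last vertex (e , h) of a row is adjacent to the first vertex (e , h')
  -- of the next row, which starts where the previous one ended (head r ≡ last p).
  junction : ∀ p r {h h'} rest → head r ≡ last p → Adj H h h' →
             Connected (Adj (G □ H)) (last (row h p)) (head (row h' r ++ rest))
  junction p [] {h} rest e _ rewrite last-map (_, h) p | sym e = nothing-connected
  junction p (c ∷ _) {h} rest e adj rewrite last-map (_, h) p | sym e = just (inj₁ (refl , adj))

  snake-Linked : ∀ {p hs} → Linked (Adj G) p → Linked (Adj H) hs → Linked (Adj (G □ H)) (snake p hs)
  snake-Linked lp [] = []
  snake-Linked lp [-] = Linked.++⁺ (row-Linked lp) connected-nothing []
  snake-Linked {p} lp (adj ∷ lh) =
    Linked.++⁺ (row-Linked lp) (junction p (reverse p) _ (head-reverse p) adj)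
      (snake-Linked (Linked.map (Graph.sym G) (reverse-Linked lp)) lh)

  -- Every vertex of the snake lies in one of the rows h ∈ hs; this keeps
  -- different rows disjoint.
  snake-rows : ∀ {v} p hs → v ∈ snake p hs → proj₂ v ∈ hs
  snake-rows p (h ∷ hs) m with ∈-++⁻ (row h p) m
  ... | inj₂ m' = there (snake-rows (reverse p) hs m')
  ... | inj₁ m' with ∈-map⁻ (_, h) m'
  ...   | _ , _ , refl = here refl

  snake-Unique : ∀ {p hs} → Unique p → Unique hs → Unique (snake p hs)
  snake-Unique up [] = []
  snake-Unique {p} {h ∷ hs} up (h∉ ∷ uh) =
    Unique.++⁺ (Unique.map⁺ (cong proj₁) up) (snake-Unique (reverse-Unique up) uh) disjoint
    where
    disjoint : Disjoint (row h p) (snake (reverse p) hs)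
    disjoint (m₁ , m₂) with ∈-map⁻ (_, h) m₁
    ... | _ , _ , refl = All.lookup h∉ (snake-rows (reverse p) hs m₂) refl

  snake-covers : ∀ {g h p hs} → (∀ g → g ∈ p) → h ∈ hs → (g , h) ∈ snake p hs
  snake-covers {g} {h} covers (here refl) = ∈-++⁺ˡ (∈-map⁺ (_, h) (covers g))
  snake-covers {p = p} {h' ∷ _} covers (there m) =
    ∈-++⁺ʳ (row h' p) (snake-covers (λ g → Any.reverse⁺ (covers g)) m)

  □-traceable : Traceable G → Traceable H → Traceable (G □ H)
  □-traceable (p , (up , lp) , cp) (q , (uq , lq) , cq) =
    snake p q , (snake-Unique up uq , snake-Linked lp lq) , λ (g , h) → snake-covers cp (cq h)

first-internal : ∀ {V} {G : Graph V} {k} (c : TotalColoring G k) {a b d} r →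
                 TotalProper c (a ∷ b ∷ d ∷ r) → TPTriple c a b d
first-internal c [] t = t
first-internal c (_ ∷ _) (t , _) = t

-- Joining two distinct non-adjacent vertices needs an internal vertex, whose
-- color and the colors of its two path edges are pairwise distinct.
tpc≥3 : ∀ {V} (G : Graph V) {x y} → x ≢ y → ¬ Adj G x y → ∀ k → TPConnectable G k → 3 ≤ k
tpc≥3 G {x} {y} x≢y x≁y k (c , connected) with connected x y
... | [] , _ , () , _
... | _ ∷ [] , _ , refl , refl , _ = ⊥-elim (x≢y refl)
... | _ ∷ _ ∷ [] , (_ , (adj ∷ [-])) , refl , refl , _ = ⊥-elim (x≁y adj)
... | a ∷ b ∷ d ∷ r , _ , _ , _ , proper with first-internal c r proper
...   | edges≢ , vertex≢in , vertex≢out =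
  three-distinct⇒3≤ (vcol c b) (ecol c a b) (ecol c b d) vertex≢in vertex≢out edges≢

theorem3p1 : (n m : ℕ) (G : FinGraph n) (H : FinGraph m) →
    Nontrivial n → Nontrivial m → Traceable G → Traceable H →
    TPC≡ (G □ H) 3
theorem3p1 _ _ G H (s≤s (s≤s _)) (s≤s (s≤s _)) traceG traceH =
  traceable⇒tpc≤3 (G □ H) (≡-dec _≟_ _≟_) (Snake.□-traceable G H traceG traceH) ,
  tpc≥3 (G □ H) corners-distinct corners-nonadjacent
  where
  corners-distinct : (zero , zero) ≢ (suc zero , suc zero)
  corners-distinct ()
  corners-nonadjacent : ¬ Adj (G □ H) (zero , zero) (suc zero , suc zero)
  corners-nonadjacent (inj₁ (() , _))
  corners-nonadjacent (inj₂ (() , _))
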